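{- Let $k\ge 2$ and let $A_k=\{a_1,\ldots,a_k\}\subset\mathbb{N}$ with $a_1<a_2<\cdots<a_k$. Let $\mathcal{C}_{A_k}$ be the set of complete words on $A_k$, $\mathcal{S}_{A_k}$ the set of superpatterns of length-$k$ preferential arrangements on $A_k$, and $\mathcal{R}_{A_k}$ the set of regular superpatterns of length-$k$ preferential arrangements on $A_k$. Then $\mathcal{C}_{A_k}=\mathcal{S}_{A_k}=\mathcal{R}_{A_k}$.
   Context: A preferential arrangement (p.a.) of length $k$ is a string of length $k$ of positive integers considered up to order isomorphism (two strings $x_1\cdots x_k$ and $y_1\cdots y_k$ are order isomorphic if for all $s,t$, $x_s<x_t \iff y_s<y_t$ and $x_s=x_t\iff y_s=y_t$); it is represented by its dense-ranking form, i.e. a string over $\{1,\ldots,m\}$ using every value in $\{1,\ldots,m\}$ for some $m$ (e.g. 112, 121, 123). A word on $A_k$ is a finite string with entries in $A_k$. An occurrence of a p.a. $\pi$ in a word $w$ is a subsequence (not necessarily contiguous) of $w$ that is order isomorphic to $\pi$. A superpattern of length-$k$ p.a.'s on $A_k$ is a word on $A_k$ containing an occurrence of every p.a. of length $k$ whose number of distinct values is at most $k$ (i.e. every length-$k$ p.a.). A complete word on $A_k$ is a word on $A_k$ containing every permutation of the elements of $A_k$ as a subsequence. A regular occurrence of a p.a. $\pi$ in a word on $A_k$ is an occurrence such that for each letter $c$ of $\pi$, if there are $i$ letters of $\pi$ (counted with multiplicity) strictly less than $c$ and $j$ copies of $c$ in $\pi$, then every position of $\pi$ carrying $c$ is represented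 in the word by an element of $\{a_{i+1},a_{i+2},\ldots,a_{i+j}\}$ (all copies of $c$ being represented by the same letter, as required by order isomorphism). For example over $[6]$, $113363$ and $225565$ are regular occurrences of $112232$, but $113343$ is not. A regular superpattern of length-$k$ p.a.'s on $A_k$ is a word on $A_k$ that contains a regular occurrence of every length-$k$ p.a. -}

module Defs where

open import Data.Nat using (ℕ; _<_; _≤_; _+_; _<?_; _≟_)
open import Data.Fin as Fin using (Fin; toℕ; cast)
open import Data.List using (List; length; lookup; filter; tabulate)
open import Data.List.Membership.Propositional using (_∈_)
open import Data.List.Relation.Unary.All using (All)
open import Data.List.Relation.Binary.Sublist.Propositional using (_⊆_)
open import Data.List.Relation.Binary.Permutation.Propositional using (_↭_)
open import Data.Product using (Σ; ∃; _×_)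
open import Relation.Binary.PropositionalEquality using (_≡_)
open import Function.Bundles using (_⇔_)

-- The alphabet A_k = {a_1 < ... < a_k} is given by a strictly increasing
-- map a : Fin k → ℕ (a 0 = a_1, ..., a (k-1) = a_k).
StrictlyIncreasing : ∀ {k} → (Fin k → ℕ) → Set
StrictlyIncreasing {k} a = ∀ (i j : Fin k) → i Fin.< j → a i < a j

alphabet : ∀ {k} → (Fin k → ℕ) → List ℕ
alphabet {k} a = tabulate a

WordOn : ∀ {k} → (Fin k → ℕ) → List ℕ → Set
WordOn {k} a w = All (λ x → ∃ λ (i : Fin k) → x ≡ a i) w

OrderIsoVia : (xs ys : List ℕ) → length xs ≡ length ys → Set
OrderIsoVia xs ys eq =
  ∀ (s t : Fin (length xs)) →
    (lookup xs s < lookup xs t ⇔ lookup ys (cast eq s) < lookup ys (cast eq t))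
    × (lookup xs s ≡ lookup xs t ⇔ lookup ys (cast eq s) ≡ lookup ys (cast eq t))

-- Dense-ranking form: the set of values is exactly {1, ..., m} for some m.
-- Preferential arrangements of length k are the lists of length k in this form.
DenseRanking : List ℕ → Set
DenseRanking π =
  ∃ λ (m : ℕ) → All (λ x → 1 ≤ x × x ≤ m) π × (∀ v → 1 ≤ v → v ≤ m → v ∈ π)

Occurs : List ℕ → List ℕ → Set
Occurs π w = ∃ λ (u : List ℕ) → u ⊆ w × Σ (length π ≡ length u) (OrderIsoVia π u)

#less : List ℕ → ℕ → ℕ
#less π c = length (filter (_<? c) π)

#equal : List ℕ → ℕ → ℕ
#equal π c = length (filter (_≟ c) π)

-- A regular occurrence of π in w (over A_k given by a): an occurrence u such that
-- each position s of π, carrying c = π_s with i letters < c and j copies of c,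
-- is represented by some a_r with r ∈ {i+1, ..., i+j} (0-based: i ≤ r < i + j).
RegularlyOccurs : ∀ {k} → (Fin k → ℕ) → List ℕ → List ℕ → Set
RegularlyOccurs {k} a π w =
  ∃ λ (u : List ℕ) → u ⊆ w × Σ (length π ≡ length u) λ eq →
    OrderIsoVia π u eq ×
    (∀ (s : Fin (length π)) → ∃ λ (r : Fin k) →
        #less π (lookup π s) ≤ toℕ r
      × toℕ r < #less π (lookup π s) + #equal π (lookup π s)
      × lookup u (cast eq s) ≡ a r)

Complete : ∀ {k} → (Fin k → ℕ) → List ℕ → Set
Complete {k} a w = ∀ (p : List ℕ) → p ↭ alphabet a → p ⊆ w

Superpattern : ℕ → List ℕ → Set
Superpattern k w = ∀ (π : List ℕ) → length π ≡ k → DenseRanking π → Occurs π w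

RegularSuperpattern : ∀ {k} → (Fin k → ℕ) → List ℕ → Set
RegularSuperpattern {k} a w =
  ∀ (π : List ℕ) → length π ≡ k → DenseRanking π → RegularlyOccurs a π w

module Submission where

-- A regular superpattern is a superpattern, so two implications remain.
-- Complete ⇒ regular: give the r-th smallest letter of π (with multiplicity) the slot a_r; the
-- slots allowed to a letter c are then exactly those of a regular occurrence.  Realise the first
-- letter c of π at the slot of c whose first occurrence in w comes last, say at w = w₁ x w₂.  The
-- remaining slots are a permutation of the rest of the alphabet, so w₂ is complete for them and
-- realises the rest of π; a later copy of c uses a slot that is x or occurs in w₁.
-- Superpattern ⇒ complete: a permutation p of A_k is order isomorphic to its ranking pattern, and
-- a word on A_k order isomorphic to p has each letter once and the same ranks as p, so it is p.

open import Defs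
open import Data.Nat using (ℕ; zero; suc; _≤_; _<_; _+_; _<?_; _≟_; z≤n; s≤s; z<s)
open import Data.Nat.Properties
open import Data.Fin as Fin using (Fin; toℕ; cast; fromℕ<)
open import Data.Fin.Properties using (toℕ-cast; toℕ-injective; toℕ<n; toℕ-fromℕ<; cast-trans; cast-involutive)
open import Data.List using (List; []; _∷_; _++_; length; lookup; filter; tabulate; map)
open import Data.List.Properties using (filter-accept; filter-reject; filter-none; filter-some; length-map; length-tabulate; map-tabulate; map-cong-local; ++-assoc)
open import Data.List.Membership.Propositional using (_∈_; _∉_)
open import Data.List.Membership.Propositional.Properties using (∈-filter⁻; ∈-filter⁺; ∈-map⁻; ∈-map⁺; ∈-∃++; ∈-++⁻; ∈-++⁺ˡ; ∈-++⁺ʳ; ∈-tabulate⁻; ∈-tabulate⁺; ∈-lookup; ∈-insert)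
open import Data.List.Membership.DecPropositional _≟_ using (_∈?_)
open import Data.List.Relation.Unary.Any as Any using (here; there)
open import Data.List.Relation.Unary.All as All using (All; []; _∷_)
open import Data.List.Relation.Unary.All.Properties using (tabulate⁺)
open import Data.List.Relation.Unary.AllPairs using (AllPairs; []; _∷_)
open import Data.List.Relation.Unary.Linked.Properties using (Linked⇒AllPairs)
open import Data.List.Relation.Unary.Unique.Propositional using (Unique)
open import Data.List.Relation.Binary.Sublist.Propositional using (_⊆_; []; _∷ʳ_; _∷_)
open import Data.List.Relation.Binary.Sublist.Propositional.Properties using (Any-resp-⊆; All-resp-⊆; ∷ˡ⁻; ++⁺ˡ; []⊆-universal)
import Data.List.Relation.Binary.Subset.Propositional.Properties as Subset
open import Data.List.Relation.Binary.Permutation.Propositional using (_↭_; ↭-sym; ↭-trans; ↭-refl; ↭-reflexive; prep)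
open import Data.List.Relation.Binary.Permutation.Propositional.Properties using (↭-length; filter-↭; ∈-resp-↭; shift; drop-∷; map⁺)
open import Data.List.Sort ≤-decTotalOrder using (sort; sort-↭; sort-↗)
open import Data.Product using (∃; ∃₂; _×_; _,_; proj₁; proj₂)
open import Data.Sum using (_⊎_; inj₁; inj₂)
open import Data.Empty using (⊥-elim)
open import Function using (_∘_)
open import Function.Bundles using (_⇔_; mk⇔; Equivalence)
import Function.Properties.Equivalence as ⇔
open import Relation.Nullary using (¬_; yes; no)
open import Relation.Unary using (Pred; Decidable)
open import Relation.Binary.Definitions using (tri<; tri≈; tri>)
open import Relation.Binary.PropositionalEquality using (_≡_; _≢_; refl; sym; trans; cong; cong₂; subst; module ≡-Reasoning)
open ≡-Reasoning

private
  variable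
    A : Set
    x : A
    xs ys w₁ w₂ : List A

∷⊆-after-first : x ∉ w₁ → (x ∷ xs) ⊆ w₁ ++ x ∷ w₂ → xs ⊆ w₂
∷⊆-after-first {w₁ = []} _ (_ ∷ʳ τ) = ∷ˡ⁻ τ
∷⊆-after-first {w₁ = []} _ (_ ∷ τ) = τ
∷⊆-after-first {w₁ = _ ∷ _} x∉ (_ ∷ʳ τ) = ∷⊆-after-first (x∉ ∘ there) τ
∷⊆-after-first {w₁ = _ ∷ _} x∉ (refl ∷ τ) = ⊥-elim (x∉ (here refl))

∈-∷⊆-++ : x ∈ w₁ → xs ⊆ ys → (x ∷ xs) ⊆ w₁ ++ ys
∈-∷⊆-++ {w₁ = _ ∷ w₁} (here refl) τ = refl ∷ ++⁺ˡ w₁ τ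
∈-∷⊆-++ (there x∈) τ = _ ∷ʳ ∈-∷⊆-++ x∈ τ

∈-++-∷⁺ : ∀ xs {ys} {y x : A} → x ∈ xs ++ ys → x ∈ xs ++ y ∷ ys
∈-++-∷⁺ xs {ys} {y} = Subset.++⁺ʳ xs (Subset.xs⊆x∷xs ys y)

module _ {p} {P : Pred A p} (P? : Decidable P) where

  count-accept : P x → length (filter P? (x ∷ xs)) ≡ suc (length (filter P? xs))
  count-accept px = cong length (filter-accept P? px)

  count-reject : ¬ P x → length (filter P? (x ∷ xs)) ≡ length (filter P? xs)
  count-reject ¬px = cong length (filter-reject P? ¬px)

  count-resp-↭ : xs ↭ ys → length (filter P? xs) ≡ length (filter P? ys)
  count-resp-↭ xs↭ys = ↭-length (filter-↭ P? xs↭ys)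

count-lookup-cong : ∀ {p q} {P : Pred A p} {Q : Pred A q} (P? : Decidable P) (Q? : Decidable Q)
  (xs ys : List A) (eq : length xs ≡ length ys) →
  (∀ t → P (lookup xs t) ⇔ Q (lookup ys (cast eq t))) →
  length (filter P? xs) ≡ length (filter Q? ys)
count-lookup-cong P? Q? [] [] eq P⇔Q = refl
count-lookup-cong P? Q? (x ∷ xs) (y ∷ ys) eq P⇔Q with P? x | Q? y
... | yes px | yes qy = cong suc (count-lookup-cong P? Q? xs ys (suc-injective eq) (P⇔Q ∘ Fin.suc))
... | yes px | no ¬qy = ⊥-elim (¬qy (Equivalence.to (P⇔Q Fin.zero) px))
... | no ¬px | yes qy = ⊥-elim (¬px (Equivalence.from (P⇔Q Fin.zero) qy))
... | no ¬px | no ¬qy = count-lookup-cong P? Q? xs ys (suc-injective eq) (P⇔Q ∘ Fin.suc)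

strictlyIncreasing-reflects-< : ∀ {k} {a : Fin k → ℕ} → StrictlyIncreasing a →
  ∀ i j → a i < a j → toℕ i < toℕ j
strictlyIncreasing-reflects-< a↑ i j ai<aj with <-cmp (toℕ i) (toℕ j)
... | tri< i<j _ _ = i<j
... | tri≈ _ i≡j _ rewrite toℕ-injective i≡j = ⊥-elim (<-irrefl refl ai<aj)
... | tri> _ _ j<i = ⊥-elim (<-asym ai<aj (a↑ j i j<i))

#less-tabulate : ∀ {k} (a : Fin k → ℕ) → StrictlyIncreasing a → ∀ i → #less (tabulate a) (a i) ≡ toℕ i
#less-tabulate {suc k} a a↑ Fin.zero =
  trans (count-reject (_<? a Fin.zero) (<-irrefl refl))
        (cong length (filter-none (_<? a Fin.zero) (tabulate⁺ λ j → <⇒≯ (a↑ Fin.zero (Fin.suc j) z<s))))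
#less-tabulate {suc k} a a↑ (Fin.suc i) =
  trans (count-accept (_<? a (Fin.suc i)) (a↑ Fin.zero (Fin.suc i) z<s))
        (cong suc (#less-tabulate (a ∘ Fin.suc) (λ i j → a↑ (Fin.suc i) (Fin.suc j) ∘ s≤s) i))

#equal-tabulate : ∀ {k} (a : Fin k → ℕ) → StrictlyIncreasing a → ∀ i → #equal (tabulate a) (a i) ≡ 1
#equal-tabulate {suc k} a a↑ Fin.zero =
  trans (count-accept (_≟ a Fin.zero) refl)
        (cong (suc ∘ length) (filter-none (_≟ a Fin.zero) (tabulate⁺ λ j → >⇒≢ (a↑ Fin.zero (Fin.suc j) z<s))))
#equal-tabulate {suc k} a a↑ (Fin.suc i) =
  trans (count-reject (_≟ a (Fin.suc i)) (<⇒≢ (a↑ Fin.zero (Fin.suc i) z<s)))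
        (#equal-tabulate (a ∘ Fin.suc) (λ i j → a↑ (Fin.suc i) (Fin.suc j) ∘ s≤s) i)

#less-↭-tabulate : ∀ {k} {a : Fin k → ℕ} → StrictlyIncreasing a →
  ∀ {xs} → xs ↭ tabulate a → ∀ i → #less xs (a i) ≡ toℕ i
#less-↭-tabulate {a = a} a↑ xs↭ i = trans (count-resp-↭ (_<? a i) xs↭) (#less-tabulate a a↑ i)

#less+#equal≤#less : ∀ (xs : List ℕ) {c c′} → c < c′ → #less xs c + #equal xs c ≤ #less xs c′
#less+#equal≤#less [] c<c′ = z≤n
#less+#equal≤#less (x ∷ xs) {c} {c′} c<c′ with <-cmp x c
... | tri< x<c x≢c _
  rewrite count-accept (_<? c) {xs = xs} x<c | count-reject (_≟ c) {xs = xs} x≢c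
        | count-accept (_<? c′) {xs = xs} (<-trans x<c c<c′) = s≤s (#less+#equal≤#less xs c<c′)
... | tri≈ _ refl _
  rewrite count-reject (_<? c) {xs = xs} (<-irrefl refl) | count-accept (_≟ c) {xs = xs} refl
        | count-accept (_<? c′) {xs = xs} c<c′ | +-suc (#less xs c) (#equal xs c) = s≤s (#less+#equal≤#less xs c<c′)
... | tri> x≮c x≢c _
  rewrite count-reject (_<? c) {xs = xs} x≮c | count-reject (_≟ c) {xs = xs} x≢c with x <? c′
...   | yes x<c′ rewrite count-accept (_<? c′) {xs = xs} x<c′ = m≤n⇒m≤1+n (#less+#equal≤#less xs c<c′)
...   | no x≮c′ rewrite count-reject (_<? c′) {xs = xs} x≮c′ = #less+#equal≤#less xs c<c′

sorted⇒lookup-between : ∀ (σ : List ℕ) → AllPairs _≤_ σ → ∀ i →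
  #less σ (lookup σ i) ≤ toℕ i × toℕ i < #less σ (lookup σ i) + #equal σ (lookup σ i)
sorted⇒lookup-between (y ∷ σ) (y≤σ ∷ _) Fin.zero
  rewrite count-reject (_<? y) {xs = σ} (<-irrefl refl)
        | filter-none (_<? y) (All.map ≤⇒≯ y≤σ)
        | count-accept (_≟ y) {xs = σ} refl = z≤n , z<s
sorted⇒lookup-between (y ∷ σ) (y≤σ ∷ sorted) (Fin.suc i)
  with sorted⇒lookup-between σ sorted i | m≤n⇒m<n∨m≡n (All.lookup y≤σ (∈-lookup i))
... | lo , hi | inj₁ y<σᵢ
  rewrite count-accept (_<? lookup σ i) {xs = σ} y<σᵢ | count-reject (_≟ lookup σ i) {xs = σ} (<⇒≢ y<σᵢ) =
    s≤s lo , s≤s hi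
... | lo , hi | inj₂ y≡σᵢ
  rewrite count-reject (_<? lookup σ i) {xs = σ} (<-irrefl y≡σᵢ) | count-accept (_≟ lookup σ i) {xs = σ} y≡σᵢ
        | +-suc (#less σ (lookup σ i)) (#equal σ (lookup σ i)) = m≤n⇒m≤1+n lo , s≤s hi

orderIso-#less : ∀ {xs ys} {eq : length xs ≡ length ys} → OrderIsoVia xs ys eq →
  ∀ s → #less xs (lookup xs s) ≡ #less ys (lookup ys (cast eq s))
orderIso-#less {xs} {ys} {eq} iso s =
  count-lookup-cong (_<? lookup xs s) (_<? lookup ys (cast eq s)) xs ys eq (λ t → proj₁ (iso t s))

orderIso-#equal : ∀ {xs ys} {eq : length xs ≡ length ys} → OrderIsoVia xs ys eq →
  ∀ s → #equal xs (lookup xs s) ≡ #equal ys (lookup ys (cast eq s))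
orderIso-#equal {xs} {ys} {eq} iso s =
  count-lookup-cong (_≟ lookup xs s) (_≟ lookup ys (cast eq s)) xs ys eq (λ t → proj₂ (iso t s))

orderIso-trans : ∀ {xs ys zs} {eq₁ : length xs ≡ length ys} {eq₂ : length ys ≡ length zs} →
  OrderIsoVia xs ys eq₁ → OrderIsoVia ys zs eq₂ → OrderIsoVia xs zs (trans eq₁ eq₂)
orderIso-trans {eq₁ = eq₁} {eq₂} iso₁ iso₂ s t
  rewrite sym (cast-trans eq₁ eq₂ s) | sym (cast-trans eq₁ eq₂ t) =
    ⇔.trans (proj₁ (iso₁ s t)) (proj₁ (iso₂ _ _)) , ⇔.trans (proj₂ (iso₁ s t)) (proj₂ (iso₂ _ _))

lookup-map-cast : ∀ (f : ℕ → ℕ) xs (eq : length xs ≡ length (map f xs)) s →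
  lookup (map f xs) (cast eq s) ≡ f (lookup xs s)
lookup-map-cast f (x ∷ xs) eq Fin.zero = refl
lookup-map-cast f (x ∷ xs) eq (Fin.suc s) = lookup-map-cast f xs (suc-injective eq) s

strictlyMonotone⇒orderIso : ∀ (f : ℕ → ℕ) (xs : List ℕ) →
  (∀ {x y} → x ∈ xs → y ∈ xs → x < y → f x < f y) →
  OrderIsoVia xs (map f xs) (sym (length-map f xs))
strictlyMonotone⇒orderIso f xs f↑ s t
  rewrite lookup-map-cast f xs (sym (length-map f xs)) s | lookup-map-cast f xs (sym (length-map f xs)) t =
    mk⇔ (f↑ u∈ v∈) reflect-< , mk⇔ (cong f) reflect-≡
  where
  u = lookup xs s
  v = lookup xs t
  u∈ = ∈-lookup s
  v∈ = ∈-lookup t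
  reflect-< : f u < f v → u < v
  reflect-< fu<fv with <-cmp u v
  ... | tri< u<v _ _ = u<v
  ... | tri≈ _ u≡v _ = ⊥-elim (<-irrefl (cong f u≡v) fu<fv)
  ... | tri> _ _ v<u = ⊥-elim (<-asym fu<fv (f↑ v∈ u∈ v<u))
  reflect-≡ : f u ≡ f v → u ≡ v
  reflect-≡ fu≡fv with <-cmp u v
  ... | tri< u<v _ _ = ⊥-elim (<-irrefl fu≡fv (f↑ u∈ v∈ u<v))
  ... | tri≈ _ u≡v _ = u≡v
  ... | tri> _ _ v<u = ⊥-elim (<-irrefl (sym fu≡fv) (f↑ v∈ u∈ v<u))

lookup-cast-injective : ∀ (xs ys : List A) (eq : length xs ≡ length ys) →
  (∀ s → lookup ys (cast eq s) ≡ lookup xs s) → ys ≡ xs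
lookup-cast-injective [] [] eq _ = refl
lookup-cast-injective (x ∷ xs) (y ∷ ys) eq ys≗xs =
  cong₂ _∷_ (ys≗xs Fin.zero) (lookup-cast-injective xs ys (suc-injective eq) (ys≗xs ∘ Fin.suc))

#equal≡1⇒Unique : ∀ (u : List ℕ) → (∀ t → #equal u (lookup u t) ≡ 1) → Unique u
#equal≡1⇒Unique [] _ = []
#equal≡1⇒Unique (x ∷ u) once = All.tabulate x∉u ∷ #equal≡1⇒Unique u once′
  where
  x-absent : #equal u x ≡ 0
  x-absent = suc-injective (trans (sym (count-accept (_≟ x) refl)) (once Fin.zero))
  x∉u : ∀ {y} → y ∈ u → x ≢ y
  x∉u y∈u refl = <-irrefl (sym x-absent) (filter-some (_≟ x) (Any.map sym y∈u))
  once′ : ∀ t → #equal u (lookup u t) ≡ 1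
  once′ t = trans (sym (count-reject (_≟ lookup u t) (x∉u (∈-lookup t)))) (once (Fin.suc t))

Unique⇒↭ : ∀ (u L : List ℕ) → Unique u → (∀ {x} → x ∈ u → x ∈ L) → length u ≡ length L → u ↭ L
Unique⇒↭ [] [] _ _ _ = ↭-refl
Unique⇒↭ (x ∷ u) L (x∉u ∷ unique) u⊆L |u|≡|L| with ∈-∃++ (u⊆L (here refl))
... | L₁ , L₂ , refl =
  ↭-trans (prep x (Unique⇒↭ u (L₁ ++ L₂) unique u⊆L₁L₂ |u|≡|L₁L₂|)) (↭-sym (shift x L₁ L₂))
  where
  u⊆L₁L₂ : ∀ {y} → y ∈ u → y ∈ L₁ ++ L₂
  u⊆L₁L₂ y∈u with ∈-++⁻ L₁ (u⊆L (there y∈u))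
  ... | inj₁ y∈L₁ = ∈-++⁺ˡ y∈L₁
  ... | inj₂ (here refl) = ⊥-elim (All.lookup x∉u y∈u refl)
  ... | inj₂ (there y∈L₂) = ∈-++⁺ʳ L₁ y∈L₂
  |u|≡|L₁L₂| : length u ≡ length (L₁ ++ L₂)
  |u|≡|L₁L₂| = suc-injective (trans |u|≡|L| (↭-length (shift x L₁ L₂)))

firstOccurrence : ∀ {x : ℕ} {w} → x ∈ w → ∃₂ λ w₁ w₂ → w ≡ w₁ ++ x ∷ w₂ × x ∉ w₁
firstOccurrence {x} {y ∷ w} x∈ with x ≟ y | x∈
... | yes refl | _ = [] , w , refl , λ ()
... | no x≢y | here x≡y = ⊥-elim (x≢y x≡y)
... | no x≢y | there x∈w with firstOccurrence x∈w
...   | w₁ , w₂ , refl , x∉w₁ = y ∷ w₁ , w₂ , refl , λ { (here x≡y) → x≢y x≡y ; (there x∈w₁) → x∉w₁ x∈w₁ }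

record LastArrival (L w : List ℕ) : Set where
  constructor lastArrival
  field
    latest : ℕ
    before after : List ℕ
    latest∈L : latest ∈ L
    split : w ≡ before ++ latest ∷ after
    latest∉before : latest ∉ before
    arrived-before : ∀ {y} → y ∈ L → y ≡ latest ⊎ y ∈ before

findLastArrival : ∀ {y} (L w : List ℕ) → y ∈ L → (∀ {z} → z ∈ L → z ∈ w) → LastArrival L w
findLastArrival (y ∷ []) w _ L⊆w with firstOccurrence (L⊆w (here refl))
... | w₁ , w₂ , split , y∉w₁ = lastArrival y w₁ w₂ (here refl) split y∉w₁ λ { (here refl) → inj₁ refl }
findLastArrival (y ∷ z ∷ L) w _ L⊆w
  with findLastArrival (z ∷ L) w (here refl) (L⊆w ∘ there)
... | lastArrival x w₁ w₂ x∈ refl x∉w₁ arrived with y ≟ x | y ∈? w₁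
...   | yes y≡x | _ = lastArrival x w₁ w₂ (there x∈) refl x∉w₁ arrived′
  where
  arrived′ : ∀ {v} → v ∈ y ∷ z ∷ L → v ≡ x ⊎ v ∈ w₁
  arrived′ (here refl) = inj₁ y≡x
  arrived′ (there v∈) = arrived v∈
...   | no _ | yes y∈w₁ = lastArrival x w₁ w₂ (there x∈) refl x∉w₁ arrived′
  where
  arrived′ : ∀ {v} → v ∈ y ∷ z ∷ L → v ≡ x ⊎ v ∈ w₁
  arrived′ (here refl) = inj₂ y∈w₁
  arrived′ (there v∈) = arrived v∈
...   | no y≢x | no y∉w₁ with ∈-++⁻ w₁ (L⊆w (here refl))
...     | inj₁ y∈w₁ = ⊥-elim (y∉w₁ y∈w₁)
...     | inj₂ (here y≡x) = ⊥-elim (y≢x y≡x)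
...     | inj₂ (there y∈w₂) with firstOccurrence y∈w₂
...       | v₁ , v₂ , refl , y∉v₁ =
  lastArrival y (w₁ ++ x ∷ v₁) v₂ (here refl) (sym (++-assoc w₁ (x ∷ v₁) (y ∷ v₂))) y∉before arrived′
  where
  y∉before : y ∉ w₁ ++ x ∷ v₁
  y∉before y∈ with ∈-++⁻ w₁ y∈
  ... | inj₁ y∈w₁ = y∉w₁ y∈w₁
  ... | inj₂ (here y≡x) = y≢x y≡x
  ... | inj₂ (there y∈v₁) = y∉v₁ y∈v₁
  arrived′ : ∀ {v} → v ∈ y ∷ z ∷ L → v ≡ y ⊎ v ∈ w₁ ++ x ∷ v₁
  arrived′ (here refl) = inj₁ refl
  arrived′ (there v∈) with arrived v∈
  ... | inj₁ refl = inj₂ (∈-++⁺ʳ w₁ (here refl))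
  ... | inj₂ v∈w₁ = inj₂ (∈-++⁺ˡ v∈w₁)

PermutationComplete : List A → List A → Set
PermutationComplete L w = ∀ p → p ↭ L → p ⊆ w

SlottedOccurrence : List ℕ → List (ℕ × ℕ) → List ℕ → Set
SlottedOccurrence π P w = ∃ λ (f : ℕ → ℕ) → map f π ⊆ w × (∀ {c} → c ∈ π → (c , f c) ∈ P)

partners : ℕ → List (ℕ × ℕ) → List ℕ
partners c P = map proj₂ (filter ((_≟ c) ∘ proj₁) P)

∈-partners⁻ : ∀ {c y P} → y ∈ partners c P → (c , y) ∈ P
∈-partners⁻ {c} {P = P} y∈ with ∈-map⁻ proj₂ y∈
... | _ , q∈ , refl with ∈-filter⁻ ((_≟ c) ∘ proj₁) {xs = P} q∈
...   | q∈P , refl = q∈P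

∈-partners⁺ : ∀ {c y P} → (c , y) ∈ P → y ∈ partners c P
∈-partners⁺ {c} cy∈P = ∈-map⁺ proj₂ (∈-filter⁺ ((_≟ c) ∘ proj₁) cy∈P refl)

partners-nonempty : ∀ {c P π} → map proj₁ P ↭ π → c ∈ π → ∃ (_∈ partners c P)
partners-nonempty P↭π c∈π with ∈-map⁻ proj₁ (∈-resp-↭ (↭-sym P↭π) c∈π)
... | (_ , y) , cy∈P , refl = y , ∈-partners⁺ cy∈P

_[_≔_] : (ℕ → ℕ) → ℕ → ℕ → ℕ → ℕ
(f [ c ≔ v ]) d with d ≟ c
... | yes _ = v
... | no _ = f d

≔-updates : ∀ f c v → (f [ c ≔ v ]) c ≡ v
≔-updates f c v with c ≟ c
... | yes _ = refl
... | no c≢c = ⊥-elim (c≢c refl)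

≔-preserves : ∀ f {c} v {d} → d ≢ c → (f [ c ≔ v ]) d ≡ f d
≔-preserves f {c} v {d} d≢c with d ≟ c
... | yes d≡c = ⊥-elim (d≢c d≡c)
... | no _ = refl

slottedOccurrence-∷ : ∀ {c x : ℕ} {π w₁ w₂ P₁ P₂} →
  (∀ {y} → (c , y) ∈ P₁ ++ (c , x) ∷ P₂ → y ≡ x ⊎ y ∈ w₁) →
  SlottedOccurrence π (P₁ ++ P₂) w₂ → SlottedOccurrence (c ∷ π) (P₁ ++ (c , x) ∷ P₂) (w₁ ++ x ∷ w₂)
slottedOccurrence-∷ {c} {x} {π} {w₁} {w₂} {P₁} {P₂} arrived (f , fπ⊆w₂ , f-slotted) with c ∈? π
... | yes c∈π = f , fcπ⊆w , slotted
  where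
  fcπ⊆w : f c ∷ map f π ⊆ w₁ ++ x ∷ w₂
  fcπ⊆w with arrived (∈-++-∷⁺ P₁ (f-slotted c∈π))
  ... | inj₁ fc≡x = ++⁺ˡ w₁ (fc≡x ∷ fπ⊆w₂)
  ... | inj₂ fc∈w₁ = ∈-∷⊆-++ fc∈w₁ (x ∷ʳ fπ⊆w₂)
  slotted : ∀ {d} → d ∈ c ∷ π → (d , f d) ∈ P₁ ++ (c , x) ∷ P₂
  slotted (here refl) = ∈-++-∷⁺ P₁ (f-slotted c∈π)
  slotted (there d∈π) = ∈-++-∷⁺ P₁ (f-slotted d∈π)
... | no c∉π = g , gcπ⊆w , slotted
  where
  g = f [ c ≔ x ]
  g≗f : ∀ {d} → d ∈ π → g d ≡ f d
  g≗f d∈π = ≔-preserves f x (λ { refl → c∉π d∈π })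
  gcπ⊆w : g c ∷ map g π ⊆ w₁ ++ x ∷ w₂
  gcπ⊆w rewrite ≔-updates f c x | map-cong-local (All.tabulate g≗f) = ++⁺ˡ w₁ (refl ∷ fπ⊆w₂)
  slotted : ∀ {d} → d ∈ c ∷ π → (d , g d) ∈ P₁ ++ (c , x) ∷ P₂
  slotted (here refl) rewrite ≔-updates f c x = ∈-insert P₁
  slotted (there d∈π) rewrite g≗f d∈π = ∈-++-∷⁺ P₁ (f-slotted d∈π)

slottedOccurrence : ∀ (π : List ℕ) (P : List (ℕ × ℕ)) {w : List ℕ} →
  map proj₁ P ↭ π → PermutationComplete (map proj₂ P) w → SlottedOccurrence π P w
slottedOccurrence [] P _ _ = (λ _ → 0) , []⊆-universal _ , λ ()
slottedOccurrence (c ∷ π) P {w} P↭cπ complete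
  with findLastArrival (partners c P) w (proj₂ (partners-nonempty P↭cπ (here refl)))
         (Any-resp-⊆ (complete _ ↭-refl) ∘ ∈-map⁺ proj₂ ∘ ∈-partners⁻)
... | lastArrival x w₁ w₂ x∈ refl x∉w₁ arrived with ∈-∃++ (∈-partners⁻ {c} {P = P} x∈)
...   | P₁ , P₂ , refl =
  slottedOccurrence-∷ (arrived ∘ ∈-partners⁺) (slottedOccurrence π (P₁ ++ P₂) P₁P₂↭π complete′)
  where
  moved : (c , x) ∷ P₁ ++ P₂ ↭ P₁ ++ (c , x) ∷ P₂
  moved = ↭-sym (shift (c , x) P₁ P₂)
  P₁P₂↭π : map proj₁ (P₁ ++ P₂) ↭ π
  P₁P₂↭π = drop-∷ (↭-trans (map⁺ proj₁ moved) P↭cπ)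
  complete′ : PermutationComplete (map proj₂ (P₁ ++ P₂)) w₂
  complete′ p p↭ = ∷⊆-after-first x∉w₁ (complete (x ∷ p) (↭-trans (prep x p↭) (map⁺ proj₂ moved)))

tabulate-lookup-cast : ∀ {n} (xs : List A) (eq : n ≡ length xs) → tabulate (lookup xs ∘ cast eq) ≡ xs
tabulate-lookup-cast {n = zero} [] _ = refl
tabulate-lookup-cast {n = suc n} (x ∷ xs) eq = cong (x ∷_) (tabulate-lookup-cast xs (suc-injective eq))

sort-lookup-between : ∀ (π : List ℕ) (i : Fin (length (sort π))) → let c = lookup (sort π) i in
  #less π c ≤ toℕ i × toℕ i < #less π c + #equal π c
sort-lookup-between π i
  rewrite sym (count-resp-↭ (_<? lookup (sort π) i) (sort-↭ π))
        | sym (count-resp-↭ (_≟ lookup (sort π) i) (sort-↭ π)) =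
    sorted⇒lookup-between (sort π) (Linked⇒AllPairs ≤-trans (sort-↗ π)) i

complete⇒regularlyOccurs : ∀ {k} {a : Fin k → ℕ} → StrictlyIncreasing a → ∀ {w} → Complete a w →
  ∀ π → length π ≡ k → RegularlyOccurs a π w
complete⇒regularlyOccurs {k} {a} a↑ {w} complete π |π|≡k =
  map f π , fπ⊆w , sym (length-map f π) , strictlyMonotone⇒orderIso f π f-mono , regular
  where
  σ = sort π
  k≡|σ| : k ≡ length σ
  k≡|σ| = trans (sym |π|≡k) (sym (↭-length (sort-↭ π)))
  slots : List (ℕ × ℕ)
  slots = tabulate (λ r → lookup σ (cast k≡|σ| r) , a r)
  slots↭π : map proj₁ slots ↭ π
  slots↭π = ↭-trans (↭-reflexive (trans (map-tabulate _ proj₁) (tabulate-lookup-cast σ k≡|σ|))) (sort-↭ π)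
  complete′ : PermutationComplete (map proj₂ slots) w
  complete′ p p↭ = complete p (↭-trans p↭ (↭-reflexive (map-tabulate _ proj₂)))
  occurrence = slottedOccurrence π slots slots↭π complete′
  f = proj₁ occurrence
  fπ⊆w = proj₁ (proj₂ occurrence)
  Slot : ℕ → Set
  Slot c = ∃ λ (r : Fin k) → #less π c ≤ toℕ r × toℕ r < #less π c + #equal π c × f c ≡ a r
  slot : ∀ {c} → c ∈ π → Slot c
  slot c∈π with ∈-tabulate⁻ (proj₂ (proj₂ occurrence) c∈π)
  ... | r , slotted with cong proj₁ slotted
  ...   | refl with sort-lookup-between π (cast k≡|σ| r)
  ...     | lo , hi rewrite toℕ-cast k≡|σ| r = r , lo , hi , cong proj₂ slotted
  f-mono : ∀ {c c′} → c ∈ π → c′ ∈ π → c < c′ → f c < f c′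
  f-mono c∈π c′∈π c<c′ with slot c∈π | slot c′∈π
  ... | r , _ , r< , fc≡ar | r′ , ≤r′ , _ , fc′≡ar′ rewrite fc≡ar | fc′≡ar′ =
    a↑ r r′ (<-≤-trans r< (≤-trans (#less+#equal≤#less π c<c′) ≤r′))
  regular : ∀ s → ∃ λ (r : Fin k) → #less π (lookup π s) ≤ toℕ r
    × toℕ r < #less π (lookup π s) + #equal π (lookup π s)
    × lookup (map f π) (cast (sym (length-map f π)) s) ≡ a r
  regular s with slot (∈-lookup s)
  ... | r , lo , hi , fc≡ar = r , lo , hi , trans (lookup-map-cast f π (sym (length-map f π)) s) fc≡ar

orderIso-↭-tabulate⇒≡ : ∀ {k} {a : Fin k → ℕ} → StrictlyIncreasing a → ∀ {p u} → p ↭ tabulate a →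
  WordOn a u → (eq : length p ≡ length u) → OrderIsoVia p u eq → u ≡ p
orderIso-↭-tabulate⇒≡ {k} {a} a↑ {p} {u} p↭ u∈A eq p≅u = lookup-cast-injective p u eq u≗p
  where
  p∈A : ∀ s → ∃ λ i → lookup p s ≡ a i
  p∈A s = ∈-tabulate⁻ (∈-resp-↭ p↭ (∈-lookup s))
  u-once : ∀ t → #equal u (lookup u t) ≡ 1
  u-once t with p∈A (cast (sym eq) t)
  ... | i , pₛ≡aᵢ = begin
      #equal u (lookup u t)            ≡⟨ cong (λ t′ → #equal u (lookup u t′)) (cast-involutive eq (sym eq) t) ⟨
      #equal u (lookup u (cast eq s))  ≡⟨ orderIso-#equal {p} {u} {eq} p≅u s ⟨
      #equal p (lookup p s)            ≡⟨ cong (#equal p) pₛ≡aᵢ ⟩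
      #equal p (a i)                   ≡⟨ count-resp-↭ (_≟ a i) p↭ ⟩
      #equal (tabulate a) (a i)        ≡⟨ #equal-tabulate a a↑ i ⟩
      1                                ∎
    where s = cast (sym eq) t
  u↭ : u ↭ tabulate a
  u↭ = Unique⇒↭ u (tabulate a) (#equal≡1⇒Unique u u-once) u⊆A (trans (sym eq) (↭-length p↭))
    where
    u⊆A : ∀ {x} → x ∈ u → x ∈ tabulate a
    u⊆A x∈u with All.lookup u∈A x∈u
    ... | i , refl = ∈-tabulate⁺ i
  u≗p : ∀ s → lookup u (cast eq s) ≡ lookup p s
  u≗p s with All.lookup u∈A (∈-lookup (cast eq s)) | p∈A s
  ... | j , uₛ≡aⱼ | i , pₛ≡aᵢ = trans uₛ≡aⱼ (trans (cong a (toℕ-injective j≡i)) (sym pₛ≡aᵢ))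
    where
    j≡i : toℕ j ≡ toℕ i
    j≡i = begin
      toℕ j                            ≡⟨ #less-↭-tabulate a↑ u↭ j ⟨
      #less u (a j)                    ≡⟨ cong (#less u) uₛ≡aⱼ ⟨
      #less u (lookup u (cast eq s))   ≡⟨ orderIso-#less {p} {u} {eq} p≅u s ⟨
      #less p (lookup p s)             ≡⟨ cong (#less p) pₛ≡aᵢ ⟩
      #less p (a i)                    ≡⟨ #less-↭-tabulate a↑ p↭ i ⟩
      toℕ i                            ∎

superpattern⇒complete : ∀ {k} {a : Fin k → ℕ} → StrictlyIncreasing a → ∀ {w} → WordOn a w →
  Superpattern k w → Complete a w
superpattern⇒complete {k} {a} a↑ {w} w∈A superpattern p p↭ =
  let u , u⊆w , eq , π≅u = superpattern π |π|≡k π-dense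
      p≅π = strictlyMonotone⇒orderIso rank p rank-mono
      p≅u = orderIso-trans {p} {π} {u} {sym (length-map rank p)} {eq} p≅π π≅u
      u≡p = orderIso-↭-tabulate⇒≡ a↑ p↭ (All-resp-⊆ u⊆w w∈A) (trans (sym (length-map rank p)) eq) p≅u
  in subst (_⊆ w) u≡p u⊆w
  where
  rank : ℕ → ℕ
  rank x = suc (#less p x)
  π = map rank p
  p∈A : ∀ {x} → x ∈ p → ∃ λ i → x ≡ a i
  p∈A x∈p = ∈-tabulate⁻ (∈-resp-↭ p↭ x∈p)
  rank-a : ∀ i → rank (a i) ≡ suc (toℕ i)
  rank-a i = cong suc (#less-↭-tabulate a↑ p↭ i)
  |π|≡k : length π ≡ k
  |π|≡k = trans (length-map rank p) (trans (↭-length p↭) (length-tabulate a))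
  π-dense : DenseRanking π
  π-dense = k , All.tabulate bounded , covered
    where
    bounded : ∀ {v} → v ∈ π → 1 ≤ v × v ≤ k
    bounded v∈π with ∈-map⁻ rank v∈π
    ... | x , x∈p , refl with p∈A x∈p
    ...   | i , refl rewrite rank-a i = s≤s z≤n , toℕ<n i
    covered : ∀ v → 1 ≤ v → v ≤ k → v ∈ π
    covered (suc v) _ v<k = subst (_∈ π) (trans (rank-a i) (cong suc (toℕ-fromℕ< v<k)))
                              (∈-map⁺ rank (∈-resp-↭ (↭-sym p↭) (∈-tabulate⁺ i)))
      where i = fromℕ< v<k
  rank-mono : ∀ {x y} → x ∈ p → y ∈ p → x < y → rank x < rank y
  rank-mono x∈p y∈p x<y with p∈A x∈p | p∈A y∈p
  ... | i , refl | j , refl rewrite rank-a i | rank-a j = s≤s (strictlyIncreasing-reflects-< a↑ i j x<y)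

regularSuperpattern⇒superpattern : ∀ {k} {a : Fin k → ℕ} {w} → RegularSuperpattern a w → Superpattern k w
regularSuperpattern⇒superpattern regular π |π|≡k dense =
  let u , u⊆w , eq , π≅u , _ = regular π |π|≡k dense in u , u⊆w , eq , π≅u

theorem1 : (k : ℕ) → 2 ≤ k → (a : Fin k → ℕ) → StrictlyIncreasing a →
    (w : List ℕ) → WordOn a w →
      (Complete a w ⇔ Superpattern k w) × (Superpattern k w ⇔ RegularSuperpattern a w)
theorem1 k _ a a↑ w w∈A =
  mk⇔ (regularSuperpattern⇒superpattern ∘ complete⇒regular) super⇒complete ,
  mk⇔ (complete⇒regular ∘ super⇒complete) regularSuperpattern⇒superpattern
  where
  complete⇒regular : Complete a w → RegularSuperpattern a w
  complete⇒regular complete π |π|≡k _ = complete⇒regularlyOccurs a↑ complete π |π|≡k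
  super⇒complete : Superpattern k w → Complete a w
  super⇒complete = superpattern⇒complete a↑ w∈A
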